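{- Let $G$ be a two-rooted Eulerian graph and let $G'=\textbf{gcds}_{\{u,v\}}(G)$ for some adjacent non-root vertices $u,v$. Then $G'$ is Eulerian.
   Context: A two-rooted graph is a finite simple undirected graph with two designated root vertices. A graph is Eulerian if every vertex has even degree. With $f_a(b)=1$ iff $a,b$ adjacent, $\textbf{gcds}_{\{p,q\}}(G)$ (for adjacent non-root $p,q$) is the graph on the same vertex set in which distinct $x,y$ are adjacent iff $f_p(x)f_q(y)+f_q(x)f_p(y)+f_x(y)\equiv 1\pmod 2$. -}

module Defs where

open import Data.Nat using (ℕ)
open import Data.Nat.Divisibility using (_∣_)
open import Data.Bool using (Bool; true; false; _∧_; _xor_; if_then_else_; not)
open import Data.Fin using (Fin)
open import Data.Fin.Properties using (_≟_)
open import Data.List using (List; filter; length)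
open import Data.List.Base using (allFin)
open import Relation.Binary.PropositionalEquality using (_≡_)
open import Relation.Nullary using (¬_; does)

-- A finite simple undirected graph on vertex set Fin n, given by its
-- Boolean adjacency function (f_a(b) = 1 iff adj a b ≡ true).
record Graph (n : ℕ) : Set where
  field
    adj   : Fin n → Fin n → Bool
    sym   : ∀ x y → adj x y ≡ adj y x
    irrefl : ∀ x → adj x x ≡ false
open Graph public

record TwoRootedGraph (n : ℕ) : Set where
  field
    graph : Graph n
    root₁ : Fin n
    root₂ : Fin n
    roots-distinct : ¬ (root₁ ≡ root₂)
open TwoRootedGraph public

isRoot : ∀ {n} → TwoRootedGraph n → Fin n → Set
isRoot G x = (x ≡ root₁ G) Data.Sum.⊎ (x ≡ root₂ G)
  where import Data.Sum

degree : ∀ {n} → Graph n → Fin n → ℕ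
degree {n} G x = length (filter (λ y → adj G x y Data.Bool.≟ true) (allFin n))
  where import Data.Bool

Eulerian : ∀ {n} → Graph n → Set
Eulerian {n} G = ∀ (x : Fin n) → 2 ∣ degree G x

gcdsAdj : ∀ {n} → Graph n → Fin n → Fin n → Fin n → Fin n → Bool
gcdsAdj G p q x y =
  if does (x ≟ y) then false
  else ((adj G p x ∧ adj G q y) xor (adj G q x ∧ adj G p y)) xor adj G x y

private
  open import Relation.Binary.PropositionalEquality using (refl; cong₂; trans) renaming (sym to ≡sym)
  open import Relation.Nullary using (yes; no)
  open import Data.Bool.Properties using (∧-comm)
  open import Data.Bool.Properties using () renaming (xor-comm to xc)

  gcdsAdj-sym : ∀ {n} (G : Graph n) p q x y → gcdsAdj G p q x y ≡ gcdsAdj G p q y x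
  gcdsAdj-sym G p q x y with x ≟ y | y ≟ x
  ... | yes _ | yes _ = refl
  ... | yes e | no ne = Data.Empty.⊥-elim (ne (≡sym e)) where import Data.Empty
  ... | no ne | yes e = Data.Empty.⊥-elim (ne (≡sym e)) where import Data.Empty
  ... | no _ | no _ =
    cong₂ _xor_
      (trans (xc (adj G p x ∧ adj G q y) (adj G q x ∧ adj G p y))
             (cong₂ _xor_ (∧-comm (adj G q x) (adj G p y)) (∧-comm (adj G p x) (adj G q y))))
      (Graph.sym G x y)

  gcdsAdj-irrefl : ∀ {n} (G : Graph n) p q x → gcdsAdj G p q x x ≡ false
  gcdsAdj-irrefl G p q x with x ≟ x
  ... | yes _ = refl
  ... | no ne = Data.Empty.⊥-elim (ne refl) where import Data.Empty

gcds : ∀ {n} → Graph n → Fin n → Fin n → Graph n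
gcds G p q = record
  { adj = gcdsAdj G p q
  ; sym = gcdsAdj-sym G p q
  ; irrefl = gcdsAdj-irrefl G p q }

-- Over GF(2) the parity of the degree of x is the sum of the row f_x of the
-- adjacency matrix.  For the new graph the row of x is
-- f_u(x) f_v + f_v(x) f_u + f_x (the diagonal term f_u(x) f_v(x) + f_v(x) f_u(x)
-- vanishes, so the formula holds at y = x too), and summing is linear, so its
-- sum is f_u(x) Σ f_v + f_v(x) Σ f_u + Σ f_x, which is 0 when all degrees are even.
module Submission where

open import Defs hiding (sym)
open import Algebra.Bundles using (CommutativeRing)
open import Data.Bool using (Bool; true; false; _∧_; _xor_; not)
import Data.Bool as Bool
open import Data.Bool.Properties
  using (∧-comm; ∧-zeroʳ; xor-same; xor-identityʳ; not-involutive; xor-∧-commutativeRing)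
open import Data.Fin using (Fin)
open import Data.Fin.Properties using (_≟_)
open import Data.List using (List; []; _∷_; filter; length; allFin)
open import Data.Nat using (ℕ; zero; suc; _*_)
open import Data.Nat.Divisibility using (_∣_; divides)
open import Relation.Binary.PropositionalEquality
  using (_≡_; refl; cong; cong₂; trans; sym; module ≡-Reasoning)
open import Relation.Nullary using (¬_; yes; no)

open import Algebra.Properties.CommutativeSemigroup
  (CommutativeRing.+-commutativeSemigroup xor-∧-commutativeRing)
  using (interchange)

odd : ℕ → Bool
odd zero    = false
odd (suc n) = not (odd n)

odd-*2 : ∀ q → odd (q * 2) ≡ false
odd-*2 zero    = refl
odd-*2 (suc q) = trans (not-involutive (odd (q * 2))) (odd-*2 q)

2∣⇒¬odd : ∀ n → 2 ∣ n → odd n ≡ false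
2∣⇒¬odd _ (divides q refl) = odd-*2 q

¬odd⇒2∣ : ∀ n → odd n ≡ false → 2 ∣ n
¬odd⇒2∣ zero          _ = divides 0 refl
¬odd⇒2∣ (suc zero)    ()
¬odd⇒2∣ (suc (suc n)) e with ¬odd⇒2∣ n (trans (sym (not-involutive (odd n))) e)
... | divides q eq = divides (suc q) (cong (λ k → suc (suc k)) eq)

xorSum : ∀ {A : Set} → (A → Bool) → List A → Bool
xorSum f []       = false
xorSum f (x ∷ xs) = f x xor xorSum f xs

odd-length-filter : ∀ {A : Set} (f : A → Bool) (xs : List A) →
  odd (length (filter (λ y → f y Bool.≟ true) xs)) ≡ xorSum f xs
odd-length-filter f []       = refl
odd-length-filter f (x ∷ xs) with f x
... | true  = cong not (odd-length-filter f xs)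
... | false = odd-length-filter f xs

xorSum-cong : ∀ {A : Set} {f g : A → Bool} → (∀ y → f y ≡ g y) →
  ∀ xs → xorSum f xs ≡ xorSum g xs
xorSum-cong f≗g []       = refl
xorSum-cong f≗g (x ∷ xs) = cong₂ _xor_ (f≗g x) (xorSum-cong f≗g xs)

xorSum-xor : ∀ {A : Set} (f g : A → Bool) xs →
  xorSum (λ y → f y xor g y) xs ≡ xorSum f xs xor xorSum g xs
xorSum-xor f g []       = refl
xorSum-xor f g (x ∷ xs) =
  trans (cong ((f x xor g x) xor_) (xorSum-xor f g xs))
        (interchange (f x) (g x) (xorSum f xs) (xorSum g xs))

xorSum-false : ∀ {A : Set} (xs : List A) → xorSum (λ _ → false) xs ≡ false
xorSum-false []       = refl
xorSum-false (x ∷ xs) = xorSum-false xs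

xorSum-∧ˡ : ∀ {A : Set} c (f : A → Bool) xs →
  xorSum (λ y → c ∧ f y) xs ≡ c ∧ xorSum f xs
xorSum-∧ˡ true  f xs = refl
xorSum-∧ˡ false f xs = xorSum-false xs

oddDegree : ∀ {n} → Graph n → Fin n → Bool
oddDegree {n} G x = xorSum (adj G x) (allFin n)

odd-degree : ∀ {n} (G : Graph n) x → odd (degree G x) ≡ oddDegree G x
odd-degree {n} G x = odd-length-filter (adj G x) (allFin n)

Eulerian⇒¬oddDegree : ∀ {n} (G : Graph n) → Eulerian G → ∀ x → oddDegree G x ≡ false
Eulerian⇒¬oddDegree G eul x = trans (sym (odd-degree G x)) (2∣⇒¬odd _ (eul x))

¬oddDegree⇒Eulerian : ∀ {n} (G : Graph n) → (∀ x → oddDegree G x ≡ false) → Eulerian G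
¬oddDegree⇒Eulerian G even x = ¬odd⇒2∣ _ (trans (odd-degree G x) (even x))

gcdsAdj-unfolded : ∀ {n} (G : Graph n) p q x y →
  gcdsAdj G p q x y ≡ ((adj G p x ∧ adj G q y) xor (adj G q x ∧ adj G p y)) xor adj G x y
gcdsAdj-unfolded G p q x y with x ≟ y
... | no _     = refl
... | yes refl = begin
  false                                      ≡⟨ sym (xor-same (px ∧ qx)) ⟩
  (px ∧ qx) xor (px ∧ qx)                    ≡⟨ sym (xor-identityʳ _) ⟩
  ((px ∧ qx) xor (px ∧ qx)) xor false        ≡⟨ cong₂ (λ a b → ((px ∧ qx) xor a) xor b)
                                                      (∧-comm px qx) (sym (irrefl G x)) ⟩
  ((px ∧ qx) xor (qx ∧ px)) xor adj G x x    ∎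
  where
  open ≡-Reasoning
  px = adj G p x
  qx = adj G q x

oddDegree-gcds : ∀ {n} (G : Graph n) p q x →
  oddDegree (gcds G p q) x
    ≡ ((adj G p x ∧ oddDegree G q) xor (adj G q x ∧ oddDegree G p)) xor oddDegree G x
oddDegree-gcds {n} G p q x = begin
  xorSum (gcdsAdj G p q x) V
    ≡⟨ xorSum-cong (gcdsAdj-unfolded G p q x) V ⟩
  xorSum (λ y → ((px ∧ adj G q y) xor (qx ∧ adj G p y)) xor adj G x y) V
    ≡⟨ xorSum-xor (λ y → (px ∧ adj G q y) xor (qx ∧ adj G p y)) (adj G x) V ⟩
  xorSum (λ y → (px ∧ adj G q y) xor (qx ∧ adj G p y)) V xor oddDegree G x
    ≡⟨ cong (_xor oddDegree G x) (xorSum-xor (λ y → px ∧ adj G q y) (λ y → qx ∧ adj G p y) V) ⟩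
  (xorSum (λ y → px ∧ adj G q y) V xor xorSum (λ y → qx ∧ adj G p y) V) xor oddDegree G x
    ≡⟨ cong (_xor oddDegree G x) (cong₂ _xor_ (xorSum-∧ˡ px (adj G q) V) (xorSum-∧ˡ qx (adj G p) V)) ⟩
  ((px ∧ oddDegree G q) xor (qx ∧ oddDegree G p)) xor oddDegree G x ∎
  where
  open ≡-Reasoning
  V  = allFin n
  px = adj G p x
  qx = adj G q x

gcds-Eulerian : ∀ {n} (G : Graph n) p q → Eulerian G → Eulerian (gcds G p q)
gcds-Eulerian G p q eul = ¬oddDegree⇒Eulerian (gcds G p q) λ x → begin
  oddDegree (gcds G p q) x
    ≡⟨ oddDegree-gcds G p q x ⟩
  ((adj G p x ∧ oddDegree G q) xor (adj G q x ∧ oddDegree G p)) xor oddDegree G x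
    ≡⟨ cong₂ (λ a b → ((adj G p x ∧ a) xor (adj G q x ∧ b)) xor oddDegree G x) (even q) (even p) ⟩
  ((adj G p x ∧ false) xor (adj G q x ∧ false)) xor oddDegree G x
    ≡⟨ cong₂ (λ a b → (a xor b) xor oddDegree G x) (∧-zeroʳ (adj G p x)) (∧-zeroʳ (adj G q x)) ⟩
  oddDegree G x
    ≡⟨ even x ⟩
  false ∎
  where
  open ≡-Reasoning
  even = Eulerian⇒¬oddDegree G eul

mainTheorem5 : ∀ {n : ℕ} (G : TwoRootedGraph n) (u v : Fin n) →
    ¬ isRoot G u → ¬ isRoot G v → adj (graph G) u v ≡ true →
    Eulerian (graph G) → Eulerian (gcds (graph G) u v)
mainTheorem5 G u v _ _ _ = gcds-Eulerian (graph G) u v
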